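{- For any two sets $A,B\subseteq\{0,1\}^+$ satisfying $\mathcal F^{\preccurlyeq_{\mathrm{nu}}}_{(A,\mathbf{FPT}_{\mathrm{nu}})}=\mathcal F^{\preccurlyeq_{\mathrm{nu}}}_{(B,\mathbf{FPT}_{\mathrm{nu}})}$ we have $\mathcal F^{\preccurlyeq_{\mathrm{nu}}}_{(A,\mathbf{FPT}_{\mathrm{nu}})}\subseteq\mathcal F^{\preccurlyeq_{\mathrm{nu}}}_{(A\triangle B,\mathbf{FPT}_{\mathrm{nu}})}$; i.e., if for every parameterization $\eta$ we have $(A,\eta)\in\mathbf{FPT}_{\mathrm{nu}}\iff(B,\eta)\in\mathbf{FPT}_{\mathrm{nu}}$, then every $\eta$ with $(A,\eta)\in\mathbf{FPT}_{\mathrm{nu}}$ satisfies $(A\triangle B,\eta)\in\mathbf{FPT}_{\mathrm{nu}}$.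
   Context: $A\triangle B=(A\setminus B)\cup(B\setminus A)$. A Turing machine $\Phi$ is a partial decision procedure for $A$ if $\Phi(x)=1\Rightarrow x\in A$ and $\Phi(x)=0\Rightarrow x\notin A$; $\mathrm{dom}(\Phi)=\{x:\Phi(x)\in\{0,1\}\}$. An $O(n^c)$-approximation for $A$ is a partial decision procedure for $A$ halting on all inputs in time $O(n^c)$; an $O(n^c)$-slice for $A$ is the domain of one. A parameter space is a nonempty set $\Omega$ with a reflexive, transitive, directed relation and an injective encoding into $\{0,1\}^+$. A parameterization over $\Omega$ is $\eta\subseteq\{0,1\}^+\times\Omega$ such that for every $x$, $\{k:(x,k)\in\eta\}$ is nonempty and upward closed; $\eta_k=\{x:(x,k)\in\eta\}$. $(A,\eta)\in\mathbf{FPT}_{\mathrm{nu}}$ if there is a constant $c$ such that every $\eta_k$ is an $O(n^c)$-slice for $A$. $\mathcal F^{\preccurlyeq_{\mathrm{nu}}}_{(A,\mathbf{FPT}_{\mathrm{nu}})}$ denotes the set of parameterizations $\eta$ with $(A,\eta)\in\mathbf{FPT}_{\mathrm{nu}}$. -}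

module Defs where

open import Data.Nat using (ℕ; zero; suc; _+_; _*_; _^_; _≤_)
open import Data.Fin using (Fin)
open import Data.Bool using (Bool; true; false)
open import Data.List using (List; []; _∷_)
open import Data.List.NonEmpty using (List⁺; _∷_) renaming (length to length⁺)
open import Data.Product using (Σ; ∃; _×_; _,_)
open import Data.Sum using (_⊎_; inj₁; inj₂)
open import Data.Empty using (⊥)
open import Relation.Nullary using (¬_)
open import Relation.Binary.PropositionalEquality using (_≡_)
open import Function.Definitions using (Injective)

Word : Set
Word = List⁺ Bool

∣_∣ : Word → ℕ
∣ x ∣ = length⁺ x

_△_ : (Word → Set) → (Word → Set) → (Word → Set)
(A △ B) x = (A x × ¬ B x) ⊎ (B x × ¬ A x)

-- Tape alphabet: Fin (3 + g); symbol 0 = blank, 1 = bit 0, 2 = bit 1.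
-- Three halting states: out1 (output 1), out0 (output 0), out? (other output).

data Halt : Set where
  out1 out0 out? : Halt

data Move : Set where
  mL mR mS : Move

Sym : ℕ → Set
Sym g = Fin (3 + g)

record TM : Set where
  field
    nstates : ℕ                      -- non-halting states: Fin (suc nstates)
    g       : ℕ
    δ       : Fin (suc nstates) → Sym g →
              (Fin (suc nstates) ⊎ Halt) × Sym g × Move
    start   : Fin (suc nstates)

module _ (M : TM) where
  open TM M

  record Config : Set where
    constructor cfg
    field
      state : Fin (suc nstates) ⊎ Halt
      left  : List (Sym g)   -- cells left of the head, nearest first
      head  : Sym g
      right : List (Sym g)   -- cells right of the head, nearest first

  blank : Sym g
  blank = Fin.zero where import Data.Fin as Fin

  bit : Bool → Sym g
  bit false = Data.Fin.suc Data.Fin.zero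
  bit true  = Data.Fin.suc (Data.Fin.suc Data.Fin.zero)

  private
    uncons : List (Sym g) → Sym g × List (Sym g)
    uncons []       = blank , []
    uncons (s ∷ ss) = s , ss

    move : Move → List (Sym g) → Sym g → List (Sym g) →
           List (Sym g) × Sym g × List (Sym g)
    move mL l h r with uncons l
    ... | h' , l' = l' , h' , h ∷ r
    move mR l h r with uncons r
    ... | h' , r' = h ∷ l , h' , r'
    move mS l h r = l , h , r

  step : Config → Config
  step (cfg (inj₂ o) l h r) = cfg (inj₂ o) l h r
  step (cfg (inj₁ q) l h r) with δ q h
  ... | q' , s , m with move m l s r
  ...   | l' , h' , r' = cfg q' l' h' r'

  init : Word → Config
  init (b ∷ bs) = cfg (inj₁ start) [] (bit b) (Data.List.map bit bs)

  iterate : ℕ → Config → Config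
  iterate zero    c = c
  iterate (suc t) c = iterate t (step c)

  run : Word → ℕ → Config
  run x t = iterate t (init x)

  HaltsIn : Word → ℕ → Halt → Set
  HaltsIn x t o = Config.state (run x t) ≡ inj₂ o

  Outputs : Word → Halt → Set
  Outputs x o = ∃ λ t → HaltsIn x t o

  InDom : Word → Set
  InDom x = Outputs x out1 ⊎ Outputs x out0

  TimeBound : ℕ → ℕ → Set
  TimeBound c d = ∀ x → ∃ λ t → t ≤ d * (∣ x ∣ ^ c) × ∃ λ o → HaltsIn x t o

PartialDecision : TM → (Word → Set) → Set
PartialDecision M A = (∀ x → Outputs M x out1 → A x) × (∀ x → Outputs M x out0 → ¬ A x)

record Approximation (c : ℕ) (A : Word → Set) : Set where
  field
    machine : TM
    sound   : PartialDecision machine A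
    const   : ℕ
    timed   : TimeBound machine c const

IsSlice : ℕ → (Word → Set) → (Word → Set) → Set
IsSlice c A S = Σ (Approximation c A) λ Φ →
  ∀ x → (S x → InDom (Approximation.machine Φ) x) × (InDom (Approximation.machine Φ) x → S x)

record ParamSpace : Set₁ where
  field
    Ω        : Set
    _≼_      : Ω → Ω → Set
    elem     : Ω                               -- nonempty
    ≼-refl   : ∀ k → k ≼ k
    ≼-trans  : ∀ {i j k} → i ≼ j → j ≼ k → i ≼ k
    directed : ∀ i j → ∃ λ k → i ≼ k × j ≼ k
    encode   : Ω → Word
    encode-injective : Injective _≡_ _≡_ encode

record Parameterization (P : ParamSpace) : Set₁ where
  open ParamSpace P
  field
    η        : Word → Ω → Set
    nonempty : ∀ x → ∃ λ k → η x k
    upward   : ∀ x {k k'} → k ≼ k' → η x k → η x k'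

slice : {P : ParamSpace} → Parameterization P → ParamSpace.Ω P → Word → Set
slice η k x = Parameterization.η η x k

FPTnu : (Word → Set) → {P : ParamSpace} → Parameterization P → Set
FPTnu A η = ∃ λ c → ∀ k → IsSlice c A (slice η k)

module Submission where

-- As (A , η) is FPT, η_k is the domain of an O(n^a)-approximation Φ₁ for A, and by
-- the hypothesis (B , η) is FPT as well, so η_k is also the domain of an O(n^b)-approximation
-- Φ₂ for B. One machine can run Φ₁ on a first track of its tape, walk back to the origin, run
-- Φ₂ on the input kept untouched on a second track, and output the exclusive or of the two
-- verdicts (undefined as soon as one of them is). This decides A △ B partially, its domain is
-- dom Φ₁ ∩ dom Φ₂ = η_k, and it halts within 2 + 2 t₁ + t₂ = O(n^(a ⊔ b)) steps.
-- To find the way back, every visited cell records on which side of the origin it lies: the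
-- visited region is an interval containing the origin, so an unvisited cell that the head has
-- just entered lies on the side towards which the head moved.

open import Defs
open import Function.Base using (id)
open import Function.Bundles using (_⇔_; mk⇔; Equivalence; _↔_; mk↔ₛ′; Inverse)
open import Function.Construct.Composition using (_↔-∘_; _⇔-∘_)
open import Function.Construct.Symmetry using (⇔-sym)
open import Function.Construct.Identity using (↔-id)
open import Data.Nat as ℕ using (ℕ; zero; suc; _≤_; z≤n; s≤s; _⊔_; _^_; _*_; _+_; NonZero)
import Data.Nat.Properties as ℕ
open import Data.Nat.Solver using (module +-*-Solver)
open import Data.Integer as ℤ using (ℤ; +_; -[1+_]; +[1+_])
import Data.Integer.Properties as ℤ
open import Data.Fin using (Fin)
open import Data.Fin.Patterns using (0F; 1F; 2F)
open import Data.Fin.Properties using (1↔⊤; 2↔Bool; +↔⊎; *↔×)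
open import Data.Bool using (Bool; true; false)
open import Data.Unit using (⊤; tt)
open import Data.Empty using (⊥-elim)
open import Data.List using (List; []; _∷_; map)
open import Data.List.Properties using (map-∘; map-cong)
open import Data.List.NonEmpty using (List⁺; _∷_)
open import Data.List.Relation.Unary.All using (All; []; _∷_; universal)
open import Data.List.Relation.Unary.All.Properties using (map⁺)
open import Data.Product using (Σ; _×_; _,_; proj₁; proj₂)
open import Data.Product.Function.NonDependent.Propositional using (_×-↔_; _×-⇔_)
open import Data.Sum using (_⊎_; inj₁; inj₂; map₁)
open import Data.Sum.Properties using (inj₂-injective; map-id)
open import Data.Sum.Function.Propositional using (_⊎-↔_)
open import Relation.Nullary using (¬_)
open import Relation.Binary.PropositionalEquality

record Tape (Γ : Set) : Set where
  constructor mkTape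
  field
    left  : List Γ
    head  : Γ
    right : List Γ

write : ∀ {Γ} → Γ → Tape Γ → Tape Γ
write a (mkTape l _ r) = mkTape l a r

shift : Move → ℤ
shift mL = -[1+ 0 ]
shift mR = + 1
shift mS = + 0

∣+shift∣≤ : ∀ p m → ℤ.∣ p ℤ.+ shift m ∣ ≤ suc ℤ.∣ p ∣
∣+shift∣≤ p m = begin
  ℤ.∣ p ℤ.+ shift m ∣        ≤⟨ ℤ.∣i+j∣≤∣i∣+∣j∣ p (shift m) ⟩
  ℤ.∣ p ∣ + ℤ.∣ shift m ∣    ≤⟨ ℕ.+-monoʳ-≤ ℤ.∣ p ∣ (∣shift∣≤1 m) ⟩
  ℤ.∣ p ∣ + 1                ≡⟨ ℕ.+-comm ℤ.∣ p ∣ 1 ⟩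
  suc ℤ.∣ p ∣                ∎
  where
  open ℕ.≤-Reasoning
  ∣shift∣≤1 : ∀ m → ℤ.∣ shift m ∣ ≤ 1
  ∣shift∣≤1 mL = s≤s z≤n
  ∣shift∣≤1 mR = s≤s z≤n
  ∣shift∣≤1 mS = z≤n

module _ {Γ : Set} (␣ : Γ) where

  nth : List Γ → ℕ → Γ
  nth []       _       = ␣
  nth (a ∷ _)  zero    = a
  nth (_ ∷ as) (suc i) = nth as i

  at : Tape Γ → ℤ → Γ
  at (mkTape _ h _) (+ zero) = h
  at (mkTape _ _ r) +[1+ i ] = nth r i
  at (mkTape l _ _) -[1+ i ] = nth l i

  move : Move → Tape Γ → Tape Γ
  move mL (mkTape []      h r)      = mkTape [] ␣ (h ∷ r)
  move mL (mkTape (a ∷ l) h r)      = mkTape l a (h ∷ r)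
  move mR (mkTape l       h [])     = mkTape (h ∷ l) ␣ []
  move mR (mkTape l       h (a ∷ r)) = mkTape (h ∷ l) a r
  move mS τ                       = τ

  at-move : ∀ m τ k → at (move m τ) k ≡ at τ (k ℤ.+ shift m)
  at-move mL (mkTape []      h r) (+ zero)     = refl
  at-move mL (mkTape (a ∷ l) h r) (+ zero)     = refl
  at-move mL (mkTape []      h r) +[1+ zero ]  = refl
  at-move mL (mkTape (a ∷ l) h r) +[1+ zero ]  = refl
  at-move mL (mkTape []      h r) +[1+ suc i ] = refl
  at-move mL (mkTape (a ∷ l) h r) +[1+ suc i ] = refl
  at-move mL (mkTape []      h r) -[1+ i ]     = refl
  at-move mL (mkTape (a ∷ l) h r) -[1+ i ]     rewrite ℕ.+-identityʳ i = refl
  at-move mR (mkTape l h [])      (+ zero)     = refl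
  at-move mR (mkTape l h (a ∷ r)) (+ zero)     = refl
  at-move mR (mkTape l h [])      +[1+ i ]     = refl
  at-move mR (mkTape l h (a ∷ r)) +[1+ i ]     rewrite ℕ.+-comm i 1 = refl
  at-move mR (mkTape l h [])      -[1+ zero ]  = refl
  at-move mR (mkTape l h (a ∷ r)) -[1+ zero ]  = refl
  at-move mR (mkTape l h [])      -[1+ suc i ] = refl
  at-move mR (mkTape l h (a ∷ r)) -[1+ suc i ] = refl
  at-move mS τ                  k            rewrite ℤ.+-identityʳ k = refl

module _ {Γ Δ : Set} (␣ : Γ) (␣′ : Δ) (R : Γ → Δ → Set) where

  Pointwise : Tape Γ → Tape Δ → Set
  Pointwise τ σ = ∀ k → R (at ␣ τ k) (at ␣′ σ k)

  pointwise-move : ∀ m {τ σ} → Pointwise τ σ → Pointwise (move ␣ m τ) (move ␣′ m σ)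
  pointwise-move m {τ} {σ} τRσ k rewrite at-move ␣ m τ k | at-move ␣′ m σ k = τRσ (k ℤ.+ shift m)

  pointwise-write : ∀ {a b τ σ} → R a b → Pointwise τ σ → Pointwise (write a τ) (write b σ)
  pointwise-write aRb τRσ (+ zero) = aRb
  pointwise-write aRb τRσ +[1+ i ] = τRσ +[1+ i ]
  pointwise-write aRb τRσ -[1+ i ] = τRσ -[1+ i ]

module _ {Γ : Set} (␣ : Γ) (P : Γ → ℤ → Set) where

  -- P holds of every cell and its absolute position, the head being at position p.
  Everywhere : ℤ → Tape Γ → Set
  Everywhere p τ = ∀ k → P (at ␣ τ k) (k ℤ.+ p)

  everywhere-move : ∀ m {p τ} → Everywhere p τ → Everywhere (p ℤ.+ shift m) (move ␣ m τ)
  everywhere-move m {p} {τ} Pτ k rewrite at-move ␣ m τ k =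
    subst (P (at ␣ τ (k ℤ.+ shift m))) (reassoc (shift m)) (Pτ (k ℤ.+ shift m))
    where
    reassoc : ∀ s → k ℤ.+ s ℤ.+ p ≡ k ℤ.+ (p ℤ.+ s)
    reassoc s = trans (ℤ.+-assoc k s p) (cong (λ i → k ℤ.+ i) (ℤ.+-comm s p))

  everywhere-origin : ∀ {τ} → Everywhere (+ 0) τ → ∀ k → P (at ␣ τ k) k
  everywhere-origin Pτ k = subst (P _) (ℤ.+-identityʳ k) (Pτ k)

  everywhere-write : ∀ {a p τ} → P a p → Everywhere p τ → Everywhere p (write a τ)
  everywhere-write {p = p} Pa Pτ (+ zero) = subst (P _) (sym (ℤ.+-identityˡ p)) Pa
  everywhere-write Pa Pτ +[1+ i ] = Pτ +[1+ i ]
  everywhere-write Pa Pτ -[1+ i ] = Pτ -[1+ i ]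

record Machine : Set₁ where
  field
    State Symbol : Set
    ␣         : Symbol
    bitSymbol : Bool → Symbol
    δ         : State → Symbol → (State ⊎ Halt) × Symbol × Move
    start     : State

module Run (M : Machine) where
  open Machine M

  record Configuration : Set where
    constructor ⟨_,_⟩
    field
      state : State ⊎ Halt
      tape  : Tape Symbol

  open Configuration public

  perform : (State ⊎ Halt) × Symbol × Move → Tape Symbol → Configuration
  perform (q , a , m) τ = ⟨ q , move ␣ m (write a τ) ⟩

  next : Configuration → Configuration
  next ⟨ inj₁ q , τ ⟩ = perform (δ q (Tape.head τ)) τ
  next ⟨ inj₂ o , τ ⟩ = ⟨ inj₂ o , τ ⟩

  advance : ℕ → Configuration → Configuration
  advance zero    c = c
  advance (suc t) c = advance t (next c)

  initial : Word → Configuration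
  initial (b ∷ bs) = ⟨ inj₁ start , mkTape [] (bitSymbol b) (map bitSymbol bs) ⟩

  HaltsWith : Word → ℕ → Halt → Set
  HaltsWith x t o = state (advance t (initial x)) ≡ inj₂ o

  advance-+ : ∀ s t c → advance (s + t) c ≡ advance t (advance s c)
  advance-+ zero    t c = refl
  advance-+ (suc s) t c = advance-+ s t (next c)

  advance-halted : ∀ t o τ → advance t ⟨ inj₂ o , τ ⟩ ≡ ⟨ inj₂ o , τ ⟩
  advance-halted zero    o τ = refl
  advance-halted (suc t) o τ = advance-halted t o τ

  stays-halted : ∀ s t c {o} → state (advance s c) ≡ inj₂ o → state (advance (s + t) c) ≡ inj₂ o
  stays-halted s t c halted rewrite advance-+ s t c with advance s c | halted
  ... | ⟨ _ , τ ⟩ | refl = cong state (advance-halted t _ τ)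

  output-unique : ∀ {s t c o o′} → state (advance s c) ≡ inj₂ o → state (advance t c) ≡ inj₂ o′ → o ≡ o′
  output-unique {s} {t} {c} haltₛ haltₜ = inj₂-injective (begin
    inj₂ _                     ≡⟨ stays-halted s t c haltₛ ⟨
    state (advance (s + t) c)  ≡⟨ cong (λ n → state (advance n c)) (ℕ.+-comm s t) ⟩
    state (advance (t + s) c)  ≡⟨ stays-halted t s c haltₜ ⟩
    inj₂ _                     ∎)
    where open ≡-Reasoning

relabel : ∀ {Q Q′ Γ Γ′ : Set} → (Q → Q′) → (Γ → Γ′) → (Q ⊎ Halt) × Γ × Move → (Q′ ⊎ Halt) × Γ′ × Move
relabel f g (q , a , m) = map₁ f q , g a , m

module Realisation (N : Machine) (T : TM)
  (encodeState  : Machine.State N → Fin (suc (TM.nstates T)))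
  (encodeSymbol : Machine.Symbol N → Sym (TM.g T)) where

  open Machine N
  open Run N

  encode : Configuration → Config T
  encode ⟨ s , mkTape l h r ⟩ = cfg (map₁ encodeState s) (map encodeSymbol l) (encodeSymbol h) (map encodeSymbol r)

  module _
    (encode-δ     : ∀ q a → TM.δ T (encodeState q) (encodeSymbol a) ≡ relabel encodeState encodeSymbol (δ q a))
    (encode-␣     : encodeSymbol ␣ ≡ 0F)
    (encode-bit   : ∀ b → encodeSymbol (bitSymbol b) ≡ bit T b)
    (encode-start : TM.start T ≡ encodeState start)
    where

    encode-next : ∀ c → step T (encode c) ≡ encode (next c)
    encode-next ⟨ inj₂ o , mkTape l h r ⟩ = refl
    encode-next ⟨ inj₁ q , mkTape l h r ⟩ rewrite encode-δ q h with δ q h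
    ... | q′ , a , mS = refl
    ... | q′ , a , mL with l
    ...   | []    = cong (λ z → cfg (map₁ encodeState q′) [] z (encodeSymbol a ∷ map encodeSymbol r)) (sym encode-␣)
    ...   | _ ∷ _ = refl
    encode-next ⟨ inj₁ q , mkTape l h r ⟩ | q′ , a , mR with r
    ...   | []    = cong (λ z → cfg (map₁ encodeState q′) (encodeSymbol a ∷ map encodeSymbol l) z []) (sym encode-␣)
    ...   | _ ∷ _ = refl

    encode-advance : ∀ t c → iterate T t (encode c) ≡ encode (advance t c)
    encode-advance zero    c = refl
    encode-advance (suc t) c = trans (cong (iterate T t) (encode-next c)) (encode-advance t (next c))

    encode-initial : ∀ x → init T x ≡ encode (initial x)
    encode-initial (b ∷ bs) rewrite encode-start | encode-bit b =
      cong (cfg _ [] _) (trans (map-cong (λ b → sym (encode-bit b)) bs) (map-∘ bs))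

    halts⇔ : ∀ x t o → HaltsIn T x t o ⇔ HaltsWith x t o
    halts⇔ x t o = mk⇔ (λ h → map₁-inj₂ (trans (cong Config.state (sym run≡)) h))
                       (λ h → trans (cong Config.state run≡) (cong (map₁ encodeState) h))
      where
      run≡ : run T x t ≡ encode (advance t (initial x))
      run≡ = trans (cong (iterate T t) (encode-initial x)) (encode-advance t (initial x))
      map₁-inj₂ : ∀ {s} → map₁ encodeState s ≡ inj₂ o → s ≡ inj₂ o
      map₁-inj₂ {inj₂ _} refl = refl

asMachine : TM → Machine
asMachine M = record
  { State = Fin (suc (TM.nstates M)) ; Symbol = Sym (TM.g M) ; ␣ = 0F
  ; bitSymbol = bit M ; δ = TM.δ M ; start = TM.start M }

asMachine-halts : ∀ M x t o → HaltsIn M x t o ⇔ Run.HaltsWith (asMachine M) x t o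
asMachine-halts M = Realisation.halts⇔ (asMachine M) M id id relabel-id refl (λ _ → refl) refl
  where
  relabel-id : ∀ q a → TM.δ M q a ≡ relabel id id (TM.δ M q a)
  relabel-id q a with TM.δ M q a
  ... | s , _ , _ = cong (_, _) (sym (map-id s))

outputs-unique : ∀ M x {o o′} → Outputs M x o → Outputs M x o′ → o ≡ o′
outputs-unique M x {o} {o′} (t , h) (t′ , h′) =
  Run.output-unique (asMachine M) {t} {t′} (Equivalence.to (asMachine-halts M x t o) h)
                                           (Equivalence.to (asMachine-halts M x t′ o′) h′)

compile : (N : Machine) {n g : ℕ} → Fin (suc n) ↔ Machine.State N → Fin (3 + g) ↔ Machine.Symbol N → TM
compile N {n} {g} Q↔ Γ↔ = record
  { nstates = n ; g = g
  ; δ = λ q a → relabel (Inverse.from Q↔) (Inverse.from Γ↔) (Machine.δ N (Inverse.to Q↔ q) (Inverse.to Γ↔ a))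
  ; start = Inverse.from Q↔ (Machine.start N) }

compile-halts : ∀ N {n g} (Q↔ : Fin (suc n) ↔ Machine.State N) (Γ↔ : Fin (3 + g) ↔ Machine.Symbol N) →
  Inverse.from Γ↔ (Machine.␣ N) ≡ 0F →
  (∀ b → Inverse.from Γ↔ (Machine.bitSymbol N b) ≡ bit (compile N Q↔ Γ↔) b) →
  ∀ {x t o} → Run.HaltsWith N x t o → HaltsIn (compile N Q↔ Γ↔) x t o
compile-halts N Q↔ Γ↔ encode-␣ encode-bit {x} {t} {o} =
  Equivalence.from (Realisation.halts⇔ N (compile N Q↔ Γ↔) (Inverse.from Q↔) (Inverse.from Γ↔) encode-δ encode-␣ encode-bit refl x t o)
  where
  encode-δ : ∀ q a → TM.δ (compile N Q↔ Γ↔) (Inverse.from Q↔ q) (Inverse.from Γ↔ a)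
                     ≡ relabel (Inverse.from Q↔) (Inverse.from Γ↔) (Machine.δ N q a)
  encode-δ q a = cong₂ (λ q′ a′ → relabel (Inverse.from Q↔) (Inverse.from Γ↔) (Machine.δ N q′ a′))
                       (Inverse.strictlyInverseˡ Q↔ q) (Inverse.strictlyInverseˡ Γ↔ a)

lockstep : ∀ (M M′ : Machine) (R : Run.Configuration M → Run.Configuration M′ → Set) →
  (∀ {c c′} → R c c′ → R (Run.next M c) (Run.next M′ c′)) →
  ∀ t {c c′} → R c c′ → R (Run.advance M t c) (Run.advance M′ t c′)
lockstep M M′ R step zero    cRc′ = cRc′
lockstep M M′ R step (suc t) cRc′ = lockstep M M′ R step t (step cRc′)

data Side : Set where
  left origin right : Side

sideOf : ℤ → Side
sideOf (+ zero) = origin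
sideOf +[1+ _ ] = right
sideOf -[1+ _ ] = left

-- The value at mS is never consulted: after such a step the head is on a visited cell.
entered : Move → Side
entered mL = left
entered mS = origin
entered mR = right

towardsOrigin : Side → Move
towardsOrigin left   = mR
towardsOrigin origin = mS
towardsOrigin right  = mL

-- A visited cell carries one symbol of each simulated tape and the side of the origin it lies
-- on; an input cell is one the first machine has not visited yet.
data Cell (Γ₁ Γ₂ : Set) : Set where
  empty   : Cell Γ₁ Γ₂
  input   : Bool → Cell Γ₁ Γ₂
  visited : Γ₁ → Γ₂ → Side → Cell Γ₁ Γ₂

-- The Move is the last move made, the Halt is the output of the first machine.
data Control (Q₁ Q₂ : Set) : Set where
  marking   : Control Q₁ Q₂
  running₁  : Q₁ → Move → Control Q₁ Q₂
  returning : Halt → Move → Control Q₁ Q₂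
  running₂  : Q₂ → Halt → Control Q₁ Q₂

module Sequence (combine : Halt → Halt → Halt) (M₁ M₂ : Machine) where
  private
    module M₁ = Machine M₁
    module M₂ = Machine M₂

  C : Set
  C = Cell M₁.Symbol M₂.Symbol

  Q : Set
  Q = Control M₁.State M₂.State

  track₁ : C → M₁.Symbol
  track₁ empty           = M₁.␣
  track₁ (input b)       = M₁.bitSymbol b
  track₁ (visited a _ _) = a

  track₂ : C → M₂.Symbol
  track₂ empty           = M₂.␣
  track₂ (input b)       = M₂.bitSymbol b
  track₂ (visited _ a _) = a

  sideAt : Move → C → Side
  sideAt m empty           = entered m
  sideAt m (input _)       = right
  sideAt m (visited _ _ s) = s

  settle : M₁.Symbol → Move → C → C
  settle a m c = visited a (track₂ c) (sideAt m c)

  afterFirst : M₁.State ⊎ Halt → Move → Q ⊎ Halt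
  afterFirst (inj₁ q) m = inj₁ (running₁ q m)
  afterFirst (inj₂ o) m = inj₁ (returning o m)

  homeward : Halt → Side → Q ⊎ Halt
  homeward o left   = inj₁ (returning o mR)
  homeward o origin = inj₁ (running₂ M₂.start o)
  homeward o right  = inj₁ (returning o mL)

  afterSecond : Halt → M₂.State ⊎ Halt → Q ⊎ Halt
  afterSecond o₁ (inj₁ q)  = inj₁ (running₂ q o₁)
  afterSecond o₁ (inj₂ o₂) = inj₂ (combine o₁ o₂)

  δ : Q → C → (Q ⊎ Halt) × C × Move
  δ marking c = inj₁ (running₁ M₁.start mS) , visited (track₁ c) (track₂ c) origin , mS
  δ (running₁ q m) c =
    let (q′ , a , m′) = M₁.δ q (track₁ c) in afterFirst q′ m′ , settle a m c , m′
  δ (returning o m) c = homeward o (sideAt m c) , settle (track₁ c) m c , towardsOrigin (sideAt m c)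
  -- Once the second machine runs, sides are no longer consulted.
  δ (running₂ q o₁) c =
    let (q′ , a , m) = M₂.δ q (track₂ c) in afterSecond o₁ q′ , visited (track₁ c) a origin , m

  machine : Machine
  machine = record { State = Q ; Symbol = C ; ␣ = empty ; bitSymbol = input ; δ = δ ; start = marking }

  private
    module R₁ = Run M₁
    module R₂ = Run M₂
  open Run machine

  NonEmpty : C → Set
  NonEmpty c = c ≢ empty

  data Placed : C → ℤ → Set where
    offOrigin     : ∀ {j} → j ≢ + 0 → Placed empty j
    rightOfOrigin : ∀ {b j} → sideOf j ≡ right → Placed (input b) j
    sideRecorded  : ∀ {a₁ a₂ s j} → s ≡ sideOf j → Placed (visited a₁ a₂ s) j

  placed-side : ∀ m {c j} → Placed c j → NonEmpty c → sideAt m c ≡ sideOf j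
  placed-side m (offOrigin _)      c≢empty = ⊥-elim (c≢empty refl)
  placed-side m (rightOfOrigin eq) _       = sym eq
  placed-side m (sideRecorded eq)  _       = eq

  OnTrack₁ : C → M₁.Symbol → Set
  OnTrack₁ c a = track₁ c ≡ a

  OnTrack₂ : C → M₂.Symbol → Set
  OnTrack₂ c a = track₂ c ≡ a

  Tracks₁ : Tape C → Tape M₁.Symbol → Set
  Tracks₁ = Pointwise empty M₁.␣ OnTrack₁

  Tracks₂ : Tape C → Tape M₂.Symbol → Set
  Tracks₂ = Pointwise empty M₂.␣ OnTrack₂

  nth-input : ∀ {B : Set} (f : C → B) bs i →
    f (nth empty (map input bs) i) ≡ nth (f empty) (map (λ b → f (input b)) bs) i
  nth-input f []       i       = refl
  nth-input f (b ∷ bs) zero    = refl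
  nth-input f (b ∷ bs) (suc i) = nth-input f bs i

  placed-input : ∀ bs i {j} → Placed (nth empty (map input bs) i) +[1+ j ]
  placed-input []       i       = offOrigin (λ ())
  placed-input (b ∷ bs) zero    = rightOfOrigin refl
  placed-input (b ∷ bs) (suc i) = placed-input bs i

  module OnInput (x : Word) where

    input₂ : Tape M₂.Symbol
    input₂ = R₂.tape (R₂.initial x)

    WellPlaced : C → ℤ → Set
    WellPlaced c j = Placed c j × track₂ c ≡ at M₂.␣ input₂ j

    -- The head is at position p and its last move was m; empty cells occur only beyond the
    -- stored lists, that is outside the visited interval.
    record Invariant (m : Move) (p : ℤ) (τ : Tape C) : Set where
      field
        left-nonempty  : All NonEmpty (Tape.left τ)
        right-nonempty : All NonEmpty (Tape.right τ)
        well-placed    : Everywhere empty WellPlaced p τ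
        head-side      : sideAt m (Tape.head τ) ≡ sideOf p

    open Invariant

    at-head : ∀ {p τ} → Everywhere empty WellPlaced p τ → WellPlaced (Tape.head τ) p
    at-head {p} E = subst (WellPlaced _) (ℤ.+-identityˡ p) (E (+ 0))

    head-side-of : ∀ m {p τ} → Everywhere empty WellPlaced p τ → NonEmpty (Tape.head τ) →
      sideAt m (Tape.head τ) ≡ sideOf p
    head-side-of m E = placed-side m (proj₁ (at-head E))

    origin-nonempty : ∀ {j} → j ≡ + 0 → ¬ WellPlaced empty j
    origin-nonempty j≡0 (offOrigin j≢0 , _) = j≢0 j≡0

    side-after-move : ∀ m {p l w r} → NonEmpty w → All NonEmpty l → All NonEmpty r →
      Everywhere empty WellPlaced p (mkTape l w r) →
      sideAt m (Tape.head (move empty m (mkTape l w r))) ≡ sideOf (p ℤ.+ shift m)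
    side-after-move mS w≢ _          _          E = head-side-of mS (everywhere-move empty WellPlaced mS E) w≢
    side-after-move mL _  (c≢ ∷ _)   _          E = head-side-of mL (everywhere-move empty WellPlaced mL E) c≢
    side-after-move mR _  _          (c≢ ∷ _)   E = head-side-of mR (everywhere-move empty WellPlaced mR E) c≢
    side-after-move mL {+ zero}   _  []         _ _ = refl
    side-after-move mL { -[1+ _ ]} _ []         _ _ = refl
    side-after-move mL {+[1+ j ]} _  []         _ E = ⊥-elim (origin-nonempty (ℤ.+-inverseˡ +[1+ j ]) (E -[1+ j ]))
    side-after-move mR {+ zero}   _  _          [] _ = refl
    side-after-move mR {+[1+ _ ]} _  _          [] _ = refl
    side-after-move mR { -[1+ j ]} _ _          [] E = ⊥-elim (origin-nonempty (ℤ.+-inverseʳ +[1+ j ]) (E +[1+ j ]))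

    nonempty-after-move : ∀ m {l w r} → NonEmpty w → All NonEmpty l → All NonEmpty r →
      All NonEmpty (Tape.left (move empty m (mkTape l w r))) × All NonEmpty (Tape.right (move empty m (mkTape l w r)))
    nonempty-after-move mL w≢ []        r≢        = [] , w≢ ∷ r≢
    nonempty-after-move mL w≢ (_ ∷ l≢)  r≢        = l≢ , w≢ ∷ r≢
    nonempty-after-move mR w≢ l≢        []        = w≢ ∷ l≢ , []
    nonempty-after-move mR w≢ l≢        (_ ∷ r≢)  = w≢ ∷ l≢ , r≢
    nonempty-after-move mS w≢ l≢        r≢        = l≢ , r≢

    invariant-step : ∀ {m p τ} → Invariant m p τ → ∀ a m′ →
      Invariant m′ (p ℤ.+ shift m′) (move empty m′ (write (settle a m (Tape.head τ)) τ))
    invariant-step {m} {p} {mkTape l h r} I a m′ = record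
      { left-nonempty  = proj₁ (nonempty-after-move m′ (λ ()) (left-nonempty I) (right-nonempty I))
      ; right-nonempty = proj₂ (nonempty-after-move m′ (λ ()) (left-nonempty I) (right-nonempty I))
      ; well-placed    = everywhere-move empty WellPlaced m′ E
      ; head-side      = side-after-move m′ (λ ()) (left-nonempty I) (right-nonempty I) E
      }
      where
      settled : WellPlaced (settle a m h) p
      settled = sideRecorded (head-side I) , proj₂ (at-head (well-placed I))
      E : Everywhere empty WellPlaced p (mkTape l (settle a m h) r)
      E = everywhere-write empty WellPlaced settled (well-placed I)

    data Returning (o : Halt) (p : ℤ) : Configuration → Set where
      returning : ∀ {m τ} → Invariant m p τ → Returning o p ⟨ inj₁ (returning o m) , τ ⟩

    data Phase₁ (p : ℤ) : R₁.Configuration → Configuration → Set where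
      running : ∀ {q m τ₁ τ} → Tracks₁ τ τ₁ → Invariant m p τ →
                Phase₁ p R₁.⟨ inj₁ q , τ₁ ⟩ ⟨ inj₁ (running₁ q m) , τ ⟩
      halted  : ∀ {o τ₁ c} → Returning o p c → Phase₁ p R₁.⟨ inj₂ o , τ₁ ⟩ c

    phase₁-step : ∀ {p q τ₁ c} → Phase₁ p R₁.⟨ inj₁ q , τ₁ ⟩ c →
      Σ ℤ λ p′ → ℤ.∣ p′ ∣ ≤ suc ℤ.∣ p ∣ × Phase₁ p′ (R₁.next R₁.⟨ inj₁ q , τ₁ ⟩) (next c)
    phase₁-step {p} {q} {τ₁} (running {m = m} {τ = τ} tracks I) with Tape.head τ₁ | tracks (+ 0)
    ... | _ | refl with M₁.δ q (track₁ (Tape.head τ))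
    ... | q′ , a , m′ = p ℤ.+ shift m′ , ∣+shift∣≤ p m′ , continue q′
      where
      tracks′ : Tracks₁ (move empty m′ (write (settle a m (Tape.head τ)) τ)) (move M₁.␣ m′ (write a τ₁))
      tracks′ = pointwise-move empty M₁.␣ OnTrack₁ m′ (pointwise-write empty M₁.␣ OnTrack₁ refl tracks)
      continue : ∀ q′ → Phase₁ (p ℤ.+ shift m′) R₁.⟨ q′ , move M₁.␣ m′ (write a τ₁) ⟩
                                 ⟨ afterFirst q′ m′ , move empty m′ (write (settle a m (Tape.head τ)) τ) ⟩
      continue (inj₁ _) = running tracks′ (invariant-step I a m′)
      continue (inj₂ _) = halted (returning (invariant-step I a m′))

    phase₁ : ∀ t {p c₁ c o} → Phase₁ p c₁ c → R₁.state (R₁.advance t c₁) ≡ inj₂ o →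
      Σ ℕ λ u → u ≤ t × Σ ℤ λ p′ → ℤ.∣ p′ ∣ ≤ ℤ.∣ p ∣ + u × Returning o p′ (advance u c)
    phase₁ zero    (running _ _) ()
    phase₁ t {p} (halted {τ₁ = τ₁} r) halts with trans (sym (cong R₁.state (R₁.advance-halted t _ τ₁))) halts
    ... | refl = 0 , z≤n , p , ℕ.m≤m+n ℤ.∣ p ∣ 0 , r
    phase₁ (suc t) {p} ph@(running _ _) halts with phase₁-step ph
    ... | p′ , p′≤ , ph′ with phase₁ t ph′ halts
    ... | u , u≤t , p″ , p″≤ , r = suc u , s≤s u≤t , p″ , bound , r
      where
      open ℕ.≤-Reasoning
      bound : ℤ.∣ p″ ∣ ≤ ℤ.∣ p ∣ + suc u
      bound = begin
        ℤ.∣ p″ ∣         ≤⟨ p″≤ ⟩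
        ℤ.∣ p′ ∣ + u     ≤⟨ ℕ.+-monoˡ-≤ u p′≤ ⟩
        suc ℤ.∣ p ∣ + u  ≡⟨ ℕ.+-suc ℤ.∣ p ∣ u ⟨
        ℤ.∣ p ∣ + suc u  ∎

    data Phase₂ (o₁ : Halt) : R₂.Configuration → Configuration → Set where
      running : ∀ {q τ₂ τ} → Tracks₂ τ τ₂ → Phase₂ o₁ R₂.⟨ inj₁ q , τ₂ ⟩ ⟨ inj₁ (running₂ q o₁) , τ ⟩
      halted  : ∀ {o₂ τ₂ τ} → Phase₂ o₁ R₂.⟨ inj₂ o₂ , τ₂ ⟩ ⟨ inj₂ (combine o₁ o₂) , τ ⟩

    phase₂-step : ∀ {o₁ c₂ c} → Phase₂ o₁ c₂ c → Phase₂ o₁ (R₂.next c₂) (next c)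
    phase₂-step {o₁} {R₂.⟨ inj₁ q , τ₂ ⟩} {⟨ _ , τ ⟩} (running tracks) with Tape.head τ₂ | tracks (+ 0)
    ... | _ | refl with M₂.δ q (track₂ (Tape.head τ))
    ... | q′ , a , m = continue q′
      where
      continue : ∀ q′ → Phase₂ o₁ R₂.⟨ q′ , move M₂.␣ m (write a τ₂) ⟩
                                  ⟨ afterSecond o₁ q′ , move empty m (write (visited (track₁ (Tape.head τ)) a origin) τ) ⟩
      continue (inj₁ _) =
        running (pointwise-move empty M₂.␣ OnTrack₂ m (pointwise-write empty M₂.␣ OnTrack₂ refl tracks))
      continue (inj₂ _) = halted
    phase₂-step halted = halted

    homeward-from-left : ∀ {o j c} → Returning o -[1+ j ] c → Returning o (-[1+ j ] ℤ.+ + 1) (next c)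
    homeward-from-left (returning {m} {τ} I)
      with sideAt m (Tape.head τ) | head-side I | invariant-step I (track₁ (Tape.head τ)) mR
    ... | _ | refl | I′ = returning I′

    homeward-from-right : ∀ {o j c} → Returning o (+ suc j) c → Returning o (+ j) (next c)
    homeward-from-right (returning {m} {τ} I)
      with sideAt m (Tape.head τ) | head-side I | invariant-step I (track₁ (Tape.head τ)) mL
    ... | _ | refl | I′ = returning I′

    arrive : ∀ {o c} → Returning o (+ 0) c → Phase₂ o (R₂.initial x) (next c)
    arrive (returning {τ = mkTape l h r} I) rewrite head-side I = running tracks
      where
      tracks : ∀ {a s} → Tracks₂ (mkTape l (visited a (track₂ h) s) r) input₂
      tracks (+ zero) = proj₂ (well-placed I (+ 0))
      tracks +[1+ i ] = proj₂ (everywhere-origin empty WellPlaced (well-placed I) +[1+ i ])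
      tracks -[1+ i ] = proj₂ (everywhere-origin empty WellPlaced (well-placed I) -[1+ i ])

    home-right : ∀ j {o c} → Returning o (+ j) c → Phase₂ o (R₂.initial x) (advance (suc j) c)
    home-right zero    r = arrive r
    home-right (suc j) r = home-right j (homeward-from-right r)

    home-left : ∀ j {o c} → Returning o -[1+ j ] c → Phase₂ o (R₂.initial x) (advance (suc (suc j)) c)
    home-left zero    r = home-right 0 (homeward-from-left r)
    home-left (suc j) r = home-left j (homeward-from-left r)

    home : ∀ {o p c} → Returning o p c → Phase₂ o (R₂.initial x) (advance (suc ℤ.∣ p ∣) c)
    home {p = + j}      = home-right j
    home {p = -[1+ j ]} = home-left j

    phase₁-initial : Phase₁ (+ 0) (R₁.initial x) (next (initial x))
    phase₁-initial = running tracks record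
      { left-nonempty  = []
      ; right-nonempty = map⁺ (universal (λ _ ()) (List⁺.tail x))
      ; well-placed    = placed
      ; head-side      = refl }
      where
      placed : Everywhere empty WellPlaced (+ 0) _
      placed (+ zero) = sideRecorded refl , refl
      placed +[1+ i ] rewrite ℕ.+-identityʳ i = placed-input (List⁺.tail x) i , nth-input track₂ (List⁺.tail x) i
      placed -[1+ i ] = offOrigin (λ ()) , refl
      tracks : Tracks₁ _ (R₁.tape (R₁.initial x))
      tracks (+ zero) = refl
      tracks +[1+ i ] = nth-input track₁ (List⁺.tail x) i
      tracks -[1+ i ] = refl

    phase₂-halted : ∀ {o₁ o₂ c₂ c} → Phase₂ o₁ c₂ c → R₂.state c₂ ≡ inj₂ o₂ → state c ≡ inj₂ (combine o₁ o₂)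
    phase₂-halted halted refl = refl

    -- One marking step, u ≤ t₁ steps of the first machine, ∣ p ∣ + 1 ≤ t₁ + 1 steps back to
    -- the origin and t₂ steps of the second machine.
    halts : ∀ {t₁ o₁ t₂ o₂} → R₁.HaltsWith x t₁ o₁ → R₂.HaltsWith x t₂ o₂ →
      Σ ℕ λ T → T ≤ 2 + (t₁ + t₁) + t₂ × HaltsWith x T (combine o₁ o₂)
    halts {t₁} {o₁} {t₂} {o₂} h₁ h₂ with phase₁ t₁ phase₁-initial h₁
    ... | u , u≤t₁ , p , ∣p∣≤u , r = suc (u + suc ℤ.∣ p ∣ + t₂) , bound , halts-with-combination
      where
      c₀ : Configuration
      c₀ = next (initial x)
      bound : suc (u + suc ℤ.∣ p ∣ + t₂) ≤ 2 + (t₁ + t₁) + t₂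
      bound rewrite ℕ.+-suc u ℤ.∣ p ∣ = s≤s (s≤s (ℕ.+-monoˡ-≤ t₂ (ℕ.+-mono-≤ u≤t₁ (ℕ.≤-trans ∣p∣≤u u≤t₁))))
      halts-with-combination : state (advance (u + suc ℤ.∣ p ∣ + t₂) c₀) ≡ inj₂ (combine o₁ o₂)
      halts-with-combination = begin
        state (advance (u + suc ℤ.∣ p ∣ + t₂) c₀)
          ≡⟨ cong state (advance-+ (u + suc ℤ.∣ p ∣) t₂ c₀) ⟩
        state (advance t₂ (advance (u + suc ℤ.∣ p ∣) c₀))
          ≡⟨ cong (λ c → state (advance t₂ c)) (advance-+ u (suc ℤ.∣ p ∣) c₀) ⟩
        state (advance t₂ (advance (suc ℤ.∣ p ∣) (advance u c₀)))
          ≡⟨ phase₂-halted (lockstep M₂ machine (Phase₂ o₁) phase₂-step t₂ (home r)) h₂ ⟩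
        inj₂ (combine o₁ o₂)
          ∎
        where open ≡-Reasoning

infixr 3 _×ᶠ_
infixr 2 _⊎ᶠ_

_⊎ᶠ_ : ∀ {m n} {A B : Set} → Fin m ↔ A → Fin n ↔ B → Fin (m + n) ↔ (A ⊎ B)
e ⊎ᶠ f = (e ⊎-↔ f) ↔-∘ +↔⊎

_×ᶠ_ : ∀ {m n} {A B : Set} → Fin m ↔ A → Fin n ↔ B → Fin (m * n) ↔ (A × B)
e ×ᶠ f = (e ×-↔ f) ↔-∘ *↔×

3↔Side : Fin 3 ↔ Side
3↔Side = mk↔ₛ′ (λ { 0F → left ; 1F → origin ; 2F → right })
               (λ { left → 0F ; origin → 1F ; right → 2F })
               (λ { left → refl ; origin → refl ; right → refl })
               (λ { 0F → refl ; 1F → refl ; 2F → refl })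

3↔Move : Fin 3 ↔ Move
3↔Move = mk↔ₛ′ (λ { 0F → mL ; 1F → mR ; 2F → mS })
               (λ { mL → 0F ; mR → 1F ; mS → 2F })
               (λ { mL → refl ; mR → refl ; mS → refl })
               (λ { 0F → refl ; 1F → refl ; 2F → refl })

3↔Halt : Fin 3 ↔ Halt
3↔Halt = mk↔ₛ′ (λ { 0F → out1 ; 1F → out0 ; 2F → out? })
               (λ { out1 → 0F ; out0 → 1F ; out? → 2F })
               (λ { out1 → refl ; out0 → refl ; out? → refl })
               (λ { 0F → refl ; 1F → refl ; 2F → refl })

Cell↔ : ∀ {k₁ k₂ Γ₁ Γ₂} → Fin k₁ ↔ Γ₁ → Fin k₂ ↔ Γ₂ → Fin (1 + (2 + k₁ * (k₂ * 3))) ↔ Cell Γ₁ Γ₂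
Cell↔ {Γ₁ = Γ₁} {Γ₂} Γ₁↔ Γ₂↔ =
  cases ↔-∘ (1↔⊤ ⊎ᶠ 2↔Bool ⊎ᶠ Γ₁↔ ×ᶠ Γ₂↔ ×ᶠ 3↔Side)
  where
  cases : (⊤ ⊎ Bool ⊎ Γ₁ × Γ₂ × Side) ↔ Cell Γ₁ Γ₂
  cases = mk↔ₛ′ (λ { (inj₁ _) → empty ; (inj₂ (inj₁ b)) → input b ; (inj₂ (inj₂ (a₁ , a₂ , s))) → visited a₁ a₂ s })
                (λ { empty → inj₁ tt ; (input b) → inj₂ (inj₁ b) ; (visited a₁ a₂ s) → inj₂ (inj₂ (a₁ , a₂ , s)) })
                (λ { empty → refl ; (input _) → refl ; (visited _ _ _) → refl })
                (λ { (inj₁ _) → refl ; (inj₂ (inj₁ _)) → refl ; (inj₂ (inj₂ _)) → refl })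

Control↔ : ∀ {k₁ k₂ Q₁ Q₂} → Fin k₁ ↔ Q₁ → Fin k₂ ↔ Q₂ →
  Fin (1 + (k₁ * 3 + (3 * 3 + k₂ * 3))) ↔ Control Q₁ Q₂
Control↔ {Q₁ = Q₁} {Q₂} Q₁↔ Q₂↔ =
  cases ↔-∘ (1↔⊤ ⊎ᶠ Q₁↔ ×ᶠ 3↔Move ⊎ᶠ 3↔Halt ×ᶠ 3↔Move ⊎ᶠ Q₂↔ ×ᶠ 3↔Halt)
  where
  cases : (⊤ ⊎ Q₁ × Move ⊎ Halt × Move ⊎ Q₂ × Halt) ↔ Control Q₁ Q₂
  cases = mk↔ₛ′ (λ { (inj₁ _) → marking ; (inj₂ (inj₁ (q , m))) → running₁ q m
                   ; (inj₂ (inj₂ (inj₁ (o , m)))) → returning o m ; (inj₂ (inj₂ (inj₂ (q , o)))) → running₂ q o })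
                (λ { marking → inj₁ tt ; (running₁ q m) → inj₂ (inj₁ (q , m))
                   ; (returning o m) → inj₂ (inj₂ (inj₁ (o , m))) ; (running₂ q o) → inj₂ (inj₂ (inj₂ (q , o))) })
                (λ { marking → refl ; (running₁ _ _) → refl ; (returning _ _) → refl ; (running₂ _ _) → refl })
                (λ { (inj₁ _) → refl ; (inj₂ (inj₁ _)) → refl ; (inj₂ (inj₂ (inj₁ _))) → refl ; (inj₂ (inj₂ (inj₂ _))) → refl })

module _ (combine : Halt → Halt → Halt) (M₁ M₂ : TM) where
  private
    n₁ n₂ : ℕ
    n₁ = TM.nstates M₁
    n₂ = TM.nstates M₂

    N : Machine
    N = Sequence.machine combine (asMachine M₁) (asMachine M₂)

    Q↔ : Fin (1 + (suc n₁ * 3 + (3 * 3 + suc n₂ * 3))) ↔ Machine.State N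
    Q↔ = Control↔ (↔-id _) (↔-id _)

    Γ↔ : Fin (1 + (2 + (3 + TM.g M₁) * ((3 + TM.g M₂) * 3))) ↔ Machine.Symbol N
    Γ↔ = Cell↔ (↔-id _) (↔-id _)

  sequence : TM
  sequence = compile N Q↔ Γ↔

  sequence-halts : ∀ {x t₁ o₁ t₂ o₂} → HaltsIn M₁ x t₁ o₁ → HaltsIn M₂ x t₂ o₂ →
    Σ ℕ λ T → T ≤ 2 + (t₁ + t₁) + t₂ × HaltsIn sequence x T (combine o₁ o₂)
  sequence-halts {x} {t₁} {o₁} {t₂} {o₂} h₁ h₂ =
    let T , T≤ , h = Sequence.OnInput.halts combine (asMachine M₁) (asMachine M₂) x {t₁} {o₁} {t₂} {o₂}
                       (Equivalence.to (asMachine-halts M₁ x t₁ o₁) h₁) (Equivalence.to (asMachine-halts M₂ x t₂ o₂) h₂)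
    in T , T≤ , compile-halts N Q↔ Γ↔ refl encode-input {x} {T} h
    where
    encode-input : ∀ b → Inverse.from Γ↔ (input b) ≡ bit sequence b
    encode-input false = refl
    encode-input true  = refl

infixl 6 _⊕_

_⊕_ : Halt → Halt → Halt
out1 ⊕ out1 = out0
out1 ⊕ out0 = out1
out0 ⊕ out1 = out1
out0 ⊕ out0 = out0
_    ⊕ _    = out?

Decides : (Word → Set) → Word → Halt → Set
Decides A x o = (o ≡ out1 → A x) × (o ≡ out0 → ¬ A x)

data Decided : Halt → Set where
  accepted : Decided out1
  rejected : Decided out0

⊕-decides-△ : ∀ {A B x} o₁ o₂ → Decides A x o₁ → Decides B x o₂ → Decides (A △ B) x (o₁ ⊕ o₂)
⊕-decides-△ out1 out1 (a , _) (b , _) = (λ ()) , λ { _ (inj₁ (_ , ¬b)) → ¬b (b refl) ; _ (inj₂ (_ , ¬a)) → ¬a (a refl) }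
⊕-decides-△ out1 out0 (a , _) (_ , ¬b) = (λ _ → inj₁ (a refl , ¬b refl)) , λ ()
⊕-decides-△ out0 out1 (_ , ¬a) (b , _) = (λ _ → inj₂ (b refl , ¬a refl)) , λ ()
⊕-decides-△ out0 out0 (_ , ¬a) (_ , ¬b) = (λ ()) , λ { _ (inj₁ (a , _)) → ¬a refl a ; _ (inj₂ (b , _)) → ¬b refl b }
⊕-decides-△ out1 out? _ _ = (λ ()) , (λ ())
⊕-decides-△ out0 out? _ _ = (λ ()) , (λ ())
⊕-decides-△ out? _    _ _ = (λ ()) , (λ ())

⊕-decided⇔ : ∀ o₁ o₂ → Decided (o₁ ⊕ o₂) ⇔ (Decided o₁ × Decided o₂)
⊕-decided⇔ o₁ o₂ = mk⇔ (split o₁ o₂) (λ (d₁ , d₂) → join d₁ d₂)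
  where
  split : ∀ o₁ o₂ → Decided (o₁ ⊕ o₂) → Decided o₁ × Decided o₂
  split out1 out1 _ = accepted , accepted
  split out1 out0 _ = accepted , rejected
  split out0 out1 _ = rejected , accepted
  split out0 out0 _ = rejected , rejected
  split out1 out? ()
  split out0 out? ()
  split out? _    ()
  join : ∀ {o₁ o₂} → Decided o₁ → Decided o₂ → Decided (o₁ ⊕ o₂)
  join accepted accepted = rejected
  join accepted rejected = accepted
  join rejected accepted = accepted
  join rejected rejected = rejected

module Halting (M : TM) (x : Word) (t : ℕ) (o : Halt) (halts : HaltsIn M x t o) where

  output-is : ∀ {o′} → Outputs M x o′ → o ≡ o′
  output-is = outputs-unique M x (t , halts)

  inDom⇔decided : InDom M x ⇔ Decided o
  inDom⇔decided = mk⇔ (λ { (inj₁ out) → subst Decided (sym (output-is out)) accepted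
                         ; (inj₂ out) → subst Decided (sym (output-is out)) rejected })
                      (λ { accepted → inj₁ (t , halts) ; rejected → inj₂ (t , halts) })

  decides : ∀ {A} → PartialDecision M A → Decides A x o
  decides (sound₁ , sound₀) = (λ { refl → sound₁ x (t , halts) }) , (λ { refl → sound₀ x (t , halts) })

module Timed {c A} (Φ : Approximation c A) (x : Word) where
  open Approximation Φ

  time : ℕ
  time = proj₁ (timed x)

  time≤ : time ≤ const * ∣ x ∣ ^ c
  time≤ = proj₁ (proj₂ (timed x))

  output : Halt
  output = proj₁ (proj₂ (proj₂ (timed x)))

  halts : HaltsIn machine x time output
  halts = proj₂ (proj₂ (proj₂ (timed x)))

  open Halting machine x time output halts public

sequence-time : ∀ {t₁ t₂ d₁ d₂ a b} n .{{_ : NonZero n}} → t₁ ≤ d₁ * n ^ a → t₂ ≤ d₂ * n ^ b →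
  2 + (t₁ + t₁) + t₂ ≤ (2 + (d₁ + d₁) + d₂) * n ^ (a ⊔ b)
sequence-time {t₁} {t₂} {d₁} {d₂} {a} {b} n t₁≤ t₂≤ = begin
  2 + (t₁ + t₁) + t₂
    ≤⟨ ℕ.+-mono-≤ (ℕ.+-mono-≤ (ℕ.*-monoʳ-≤ 2 1≤nᶜ) (ℕ.+-mono-≤ t₁≤′ t₁≤′)) t₂≤′ ⟩
  2 * nᶜ + (d₁ * nᶜ + d₁ * nᶜ) + d₂ * nᶜ
    ≡⟨ solve 3 (λ d₁ d₂ m → con 2 :* m :+ (d₁ :* m :+ d₁ :* m) :+ d₂ :* m := (con 2 :+ (d₁ :+ d₁) :+ d₂) :* m)
             refl d₁ d₂ nᶜ ⟩
  (2 + (d₁ + d₁) + d₂) * nᶜ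
    ∎
  where
  open ℕ.≤-Reasoning
  open +-*-Solver
  nᶜ : ℕ
  nᶜ = n ^ (a ⊔ b)
  1≤nᶜ : 1 ≤ nᶜ
  1≤nᶜ = ℕ.m^n>0 n (a ⊔ b)
  t₁≤′ : t₁ ≤ d₁ * nᶜ
  t₁≤′ = ℕ.≤-trans t₁≤ (ℕ.*-monoʳ-≤ d₁ (ℕ.^-monoʳ-≤ n (ℕ.m≤m⊔n a b)))
  t₂≤′ : t₂ ≤ d₂ * nᶜ
  t₂≤′ = ℕ.≤-trans t₂≤ (ℕ.*-monoʳ-≤ d₂ (ℕ.^-monoʳ-≤ n (ℕ.m≤n⊔m a b)))

module XorApproximation {a b A B} (Φ₁ : Approximation a A) (Φ₂ : Approximation b B) where
  open Approximation Φ₁ using () renaming (machine to M₁; const to d₁; sound to sound₁)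
  open Approximation Φ₂ using () renaming (machine to M₂; const to d₂; sound to sound₂)

  machine : TM
  machine = sequence _⊕_ M₁ M₂

  module At (x : Word) where
    module R₁ = Timed Φ₁ x
    module R₂ = Timed Φ₂ x

    sequenced : Σ ℕ λ T → T ≤ 2 + (R₁.time + R₁.time) + R₂.time × HaltsIn machine x T (R₁.output ⊕ R₂.output)
    sequenced = sequence-halts _⊕_ M₁ M₂ {x} {R₁.time} {R₁.output} {R₂.time} {R₂.output} R₁.halts R₂.halts

    open Halting machine x (proj₁ sequenced) (R₁.output ⊕ R₂.output) (proj₂ (proj₂ sequenced)) public

    time≤ : proj₁ sequenced ≤ (2 + (d₁ + d₁) + d₂) * ∣ x ∣ ^ (a ⊔ b)
    time≤ = ℕ.≤-trans (proj₁ (proj₂ sequenced)) (sequence-time {d₁ = d₁} {d₂} {a} {b} ∣ x ∣ R₁.time≤ R₂.time≤)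

    decides-△ : Decides (A △ B) x (R₁.output ⊕ R₂.output)
    decides-△ = ⊕-decides-△ {A} {B} R₁.output R₂.output (R₁.decides sound₁) (R₂.decides sound₂)

  approximation : Approximation (a ⊔ b) (A △ B)
  approximation = record
    { machine = machine
    ; sound   = (λ x out → proj₁ (At.decides-△ x) (At.output-is x out))
              , (λ x out → proj₂ (At.decides-△ x) (At.output-is x out))
    ; const   = 2 + (d₁ + d₁) + d₂
    ; timed   = λ x → proj₁ (At.sequenced x) , At.time≤ x , _ , proj₂ (proj₂ (At.sequenced x))
    }

  inDom⇔ : ∀ x → InDom machine x ⇔ (InDom M₁ x × InDom M₂ x)
  inDom⇔ x = ⇔-sym (R₁.inDom⇔decided ×-⇔ R₂.inDom⇔decided) ⇔-∘ (⊕-decided⇔ R₁.output R₂.output ⇔-∘ inDom⇔decided)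
    where open At x

△-slice : ∀ {a b A B S} → IsSlice a A S → IsSlice b B S → IsSlice (a ⊔ b) (A △ B) S
△-slice (Φ₁ , dom₁) (Φ₂ , dom₂) = approximation , λ x →
    (λ s → Equivalence.from (inDom⇔ x) (proj₁ (dom₁ x) s , proj₁ (dom₂ x) s))
  , (λ d → proj₂ (dom₁ x) (proj₁ (Equivalence.to (inDom⇔ x) d)))
  where open XorApproximation Φ₁ Φ₂

theorem8 : (A B : Word → Set) →
    ((P : ParamSpace) (η : Parameterization P) → FPTnu A η ⇔ FPTnu B η) →
    (P : ParamSpace) (η : Parameterization P) → FPTnu A η → FPTnu (A △ B) η
theorem8 A B same-FPT P η FPT-A =
  let c₁ , slices₁ = FPT-A
      c₂ , slices₂ = Equivalence.to (same-FPT P η) FPT-A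
  in c₁ ⊔ c₂ , λ k → △-slice (slices₁ k) (slices₂ k)
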